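{- Let $G$ be a finite graph and $H$ an isometric subgraph of $G$. Suppose that for every node $x\in V(G)\setminus V(H)$ and every positive integer $r$ there exists a node $f_r(x)\in V(H)$ with $N_r[x]\cap V(H)\subseteq N^H_r[f_r(x)]$. Then $b(H)\le b(G)$.
   Context: $H$ is an isometric subgraph of $G$ if $d_H(u,v)=d_G(u,v)$ for all $u,v\in V(H)$. For a node $v$ and integer $r\ge 0$, $N_r[v]=\{u\in V(G): d_G(u,v)\le r\}$ and $N^H_r[v]=\{u\in V(H): d_H(u,v)\le r\}$. Burning process: in round 1 one node is chosen and burned; in each round $t\ge 2$, every unburned neighbour of a node burned by the end of round $t-1$ becomes burned, and one additional unburned node (if available) is chosen and burned; burned nodes stay burned. The burning number $b(\cdot)$ is the minimum number of rounds needed until all nodes are burned. -}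

module Defs where

open import Data.Nat using (ℕ; zero; suc; _≤_; _<_)
open import Data.Fin using (Fin)
open import Data.Maybe using (Maybe; just; nothing)
open import Data.Product using (Σ; ∃; _×_)
open import Data.Sum using (_⊎_)
open import Data.Empty using (⊥)
open import Relation.Nullary using (¬_)
open import Relation.Binary.PropositionalEquality using (_≡_)

record Graph : Set₁ where
  field
    n      : ℕ
    Adj    : Fin n → Fin n → Set
    sym    : ∀ {u v} → Adj u v → Adj v u
    irrefl : ∀ {u} → ¬ Adj u u
open Graph public

-- Dist≤ G u v k : d_G(u,v) ≤ k  (there is a walk of length ≤ k from u to v).
data Dist≤ (G : Graph) : Fin (n G) → Fin (n G) → ℕ → Set where
  here : ∀ {u k} → Dist≤ G u u k
  step : ∀ {u w v k} → Adj G u w → Dist≤ G w v k → Dist≤ G u v (suc k)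

record Subgraph (H G : Graph) : Set where
  field
    emb      : Fin (n H) → Fin (n G)
    emb-inj  : ∀ {a b} → emb a ≡ emb b → a ≡ b
    emb-edge : ∀ {a b} → Adj H a b → Adj G (emb a) (emb b)
open Subgraph public

-- Isometric: d_H(a,b) = d_G(a,b) for all a,b ∈ V(H)
-- (expressed as: for all k, d_H(a,b) ≤ k iff d_G(a,b) ≤ k; this also covers d = ∞).
IsIsometric : (H G : Graph) → Subgraph H G → Set
IsIsometric H G S = ∀ a b k →
  (Dist≤ H a b k → Dist≤ G (emb S a) (emb S b) k) ×
  (Dist≤ G (emb S a) (emb S b) k → Dist≤ H a b k)

-- Burning process.
-- A strategy c assigns to round (suc t) the (optional) chosen node  c t.

module _ (G : Graph) (c : ℕ → Maybe (Fin (n G))) where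

  -- Burned t v : v is burned by the end of round t (round 0 = nothing burned).
  -- Spread t v : v is burned by the end of round t or is a neighbour of such a node
  --              (i.e. burned after the spreading step of round t+1).
  Burned : ℕ → Fin (n G) → Set
  Spread : ℕ → Fin (n G) → Set
  Spread t v = Burned t v ⊎ Σ (Fin (n G)) (λ u → Adj G u v × Burned t u)
  Burned zero    v = ⊥
  Burned (suc t) v = Spread t v ⊎ c t ≡ just v

  -- Validity of the choice in round (suc t): the chosen node must be unburned;
  -- a choice may be skipped only if no unburned node is available.
  ValidRound : ℕ → Set
  ValidRound t =
    (∀ v → c t ≡ just v → ¬ Spread t v) ×
    (c t ≡ nothing → ∀ v → Spread t v)

BurnsIn : Graph → ℕ → Set
BurnsIn G k = Σ (ℕ → Maybe (Fin (n G))) λ c →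
  (∀ t → t < k → ValidRound G c t) × (∀ v → Burned G c k v)

IsBurningNumber : Graph → ℕ → Set
IsBurningNumber G b = BurnsIn G b × (∀ k → k < b → ¬ BurnsIn G k)

module Submission where

-- Let G burn in bG rounds with strategy c, and suppose bH > bG.
-- Every node a of H is reached in G from a source x chosen in some round t+1,
-- with d_G(x,a) ≤ d where t+1+d = bG.  Replace x by its "shadow" in H: x itself
-- if x ∈ V(H) (isometry turns the G-walk into an H-walk), otherwise f_d(x) from
-- the hypothesis (d = 0 is impossible for x ∉ V(H)).  The shadows form a
-- *plan* for H that covers every node within the remaining time.  A plan need
-- not be a valid burning sequence (a planned node may already burn), so we run
-- the greedy strategy that burns the planned node when it is unburned and some
-- other unburned node otherwise; it is valid and every planned node is burned by
-- its round, hence H burns in bG rounds, contradicting minimality of bH.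
-- Greedy choices need decidable adjacency in H, which is not given; as the goal
-- of the contradiction is ⊥ we may assume it, since decidability of a relation
-- on a finite set holds up to double negation.

open import Defs
open import Data.Nat using (ℕ; zero; suc; _≤_; _<_; _+_; _∸_; s≤s; z≤n; _≤?_)
open import Data.Nat.Properties
  using (+-suc; +-identityʳ; m+n∸m≡n; ≰⇒>; ≤-refl; ≤-pred; m≤n⇒m≤1+n; ≤∧≢⇒<)
  renaming (_≟_ to _≟ℕ_)
open import Data.Fin using (Fin; zero; suc) renaming (_≟_ to _≟Fin_)
open import Data.Fin.Properties using (any?)
open import Data.Maybe using (Maybe; just; nothing)
open import Data.Maybe.Properties using (≡-dec)
open import Data.Product using (Σ; ∃; _×_; _,_; proj₁; proj₂)
open import Data.Sum using (inj₁; inj₂)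
open import Data.Empty using (⊥-elim)
open import Function using (_∘_)
open import Relation.Nullary using (¬_; Dec; yes; no)
open import Relation.Nullary.Decidable using (_⊎-dec_; _×-dec_; ¬?; decidable-stable; ¬¬-excluded-middle)
open import Relation.Binary.PropositionalEquality using (_≡_; refl; trans; cong) renaming (sym to ≡-sym)

¬¬-Π-Fin : ∀ m {P : Fin m → Set} → (∀ i → ¬ ¬ P i) → ¬ ¬ (∀ i → P i)
¬¬-Π-Fin zero    ¬¬P k = k (λ ())
¬¬-Π-Fin (suc m) ¬¬P k =
  ¬¬P zero λ p₀ → ¬¬-Π-Fin m (λ i → ¬¬P (suc i)) λ p₊ →
    k λ { zero → p₀ ; (suc i) → p₊ i }

¬¬-adjacency-decidable : (G : Graph) → ¬ ¬ (∀ u v → Dec (Adj G u v))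
¬¬-adjacency-decidable G =
  ¬¬-Π-Fin (n G) λ u → ¬¬-Π-Fin (n G) λ v → ¬¬-excluded-middle

walk-zero : ∀ {G u v} → Dist≤ G u v 0 → u ≡ v
walk-zero here = refl

walk-weaken : ∀ {G u v d} → Dist≤ G u v d → Dist≤ G u v (suc d)
walk-weaken here       = here
walk-weaken (step e p) = step e (walk-weaken p)

walk-snoc : ∀ {G x u v d} → Dist≤ G x u d → Adj G u v → Dist≤ G x v (suc d)
walk-snoc here       e = step e here
walk-snoc (step a p) e = step a (walk-snoc p e)

module _ (G : Graph) where

  Strategy : Set
  Strategy = ℕ → Maybe (Fin (n G))

  burned-later : ∀ c m k v → Burned G c m v → Burned G c (m + k) v
  burned-later c m zero    v b rewrite +-identityʳ m = b
  burned-later c m (suc k) v b rewrite +-suc m k = inj₁ (inj₁ (burned-later c m k v b))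

  burned-spread : ∀ c m y a d → Burned G c m y → Dist≤ G y a d → Burned G c (m + d) a
  burned-spread c m y .y d b here = burned-later c m d y b
  burned-spread c m y a (suc d) b (step {w = w} e p) rewrite +-suc m d =
    burned-spread c (suc m) w a d (inj₁ (inj₂ (y , e , b))) p

  Source : Strategy → ℕ → Fin (n G) → Set
  Source c k v = Σ ℕ λ t → Σ (Fin (n G)) λ x → c t ≡ just x ×
                 Σ ℕ λ d → suc (t + d) ≡ k × Dist≤ G x v d

  burned-has-source : ∀ c k v → Burned G c k v → Source c k v
  burned-has-source c (suc k) v (inj₂ chosen) =
    k , v , chosen , 0 , cong suc (+-identityʳ k) , here
  burned-has-source c (suc k) v (inj₁ (inj₁ b)) with burned-has-source c k v b
  ... | t , x , cx , d , t+d , p = t , x , cx , suc d , cong suc (trans (+-suc t d) t+d) , walk-weaken p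
  burned-has-source c (suc k) v (inj₁ (inj₂ (u , e , b))) with burned-has-source c k u b
  ... | t , x , cx , d , t+d , p = t , x , cx , suc d , cong suc (trans (+-suc t d) t+d) , walk-snoc p e

  source-burned : ∀ c p k v → (∀ t y → p t ≡ just y → Burned G c (suc t) y) →
                  Source p k v → Burned G c k v
  source-burned c p k v follows (t , y , py , d , refl , walk) =
    burned-spread c (suc t) y v d (follows t y py) walk

  AgreeBefore : Strategy → Strategy → ℕ → Set
  AgreeBefore c c′ t = ∀ s → s < t → c s ≡ c′ s

  burned-agree : ∀ c c′ t → AgreeBefore c c′ t → ∀ v → Burned G c t v → Burned G c′ t v
  spread-agree : ∀ c c′ t → AgreeBefore c c′ t → ∀ v → Spread G c t v → Spread G c′ t v
  spread-agree c c′ t agree v (inj₁ b)           = inj₁ (burned-agree c c′ t agree v b)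
  spread-agree c c′ t agree v (inj₂ (u , e , b)) = inj₂ (u , e , burned-agree c c′ t agree u b)
  burned-agree c c′ (suc t) agree v (inj₁ s) =
    inj₁ (spread-agree c c′ t (λ s s<t → agree s (m≤n⇒m≤1+n s<t)) v s)
  burned-agree c c′ (suc t) agree v (inj₂ chosen) = inj₂ (trans (≡-sym (agree t ≤-refl)) chosen)

  module _ (adj? : ∀ u v → Dec (Adj G u v)) (c : Strategy) where
    burned? : ∀ t v → Dec (Burned G c t v)
    spread? : ∀ t v → Dec (Spread G c t v)
    spread? t v = burned? t v ⊎-dec any? (λ u → adj? u v ×-dec burned? t u)
    burned? zero    v = no (λ ())
    burned? (suc t) v = spread? t v ⊎-dec ≡-dec _≟Fin_ (c t) (just v)

record Choice {m : ℕ} (Done : Fin m → Set) (preferred : Maybe (Fin m)) : Set where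
  field
    value     : Maybe (Fin m)
    fresh     : ∀ w → value ≡ just w → ¬ Done w
    exhausted : value ≡ nothing → ∀ v → Done v
    prefers   : ∀ y → preferred ≡ just y → ¬ Done y → value ≡ just y
open Choice

module _ {m : ℕ} {Done : Fin m → Set} (Done? : ∀ v → Dec (Done v)) where

  choose-available : ∀ preferred → (∀ y → preferred ≡ just y → Done y) →
                     Dec (∃ λ v → ¬ Done v) → Choice Done preferred
  choose-available preferred unavailable (yes (v , ¬done)) = record
    { value = just v ; fresh = λ { _ refl → ¬done } ; exhausted = λ ()
    ; prefers = λ y eq ¬done-y → ⊥-elim (¬done-y (unavailable y eq)) }
  choose-available preferred unavailable (no none) = record
    { value = nothing ; fresh = λ _ ()
    ; exhausted = λ _ v → decidable-stable (Done? v) (λ ¬done → none (v , ¬done))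
    ; prefers = λ y eq ¬done-y → ⊥-elim (¬done-y (unavailable y eq)) }

  choose : ∀ preferred → Choice Done preferred
  choose nothing  = choose-available nothing (λ _ ()) (any? (λ v → ¬? (Done? v)))
  choose (just y) with Done? y
  ... | no ¬done = record
    { value = just y ; fresh = λ { _ refl → ¬done } ; exhausted = λ ()
    ; prefers = λ { _ refl _ → refl } }
  ... | yes done = choose-available (just y) (λ { _ refl → done }) (any? (λ v → ¬? (Done? v)))

override : {A : Set} → (ℕ → A) → ℕ → A → ℕ → A
override c t x s with s ≟ℕ t
... | yes _ = x
... | no  _ = c s

module FollowPlan (H : Graph) (adj? : ∀ u v → Dec (Adj H u v)) (plan : Strategy H) where

  next : (c : Strategy H) (t : ℕ) → Choice (Spread H c t) (plan t)
  next c t = choose (spread? H adj? c t) (plan t)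

  -- history t: a strategy whose first t choices are the greedy ones.
  history : ℕ → Strategy H
  history zero    = λ _ → nothing
  history (suc t) = override (history t) t (value (next (history t) t))

  greedy : Strategy H
  greedy t = value (next (history t) t)

  history-agrees : ∀ t → AgreeBefore H (history t) greedy t
  history-agrees zero    s ()
  history-agrees (suc t) s s<1+t with s ≟ℕ t
  ... | yes refl = refl
  ... | no  s≢t  = history-agrees t s (≤∧≢⇒< (≤-pred s<1+t) s≢t)

  spread-history : ∀ t v → Spread H (history t) t v → Spread H greedy t v
  spread-history t = spread-agree H (history t) greedy t (history-agrees t)

  spread-greedy : ∀ t v → Spread H greedy t v → Spread H (history t) t v
  spread-greedy t = spread-agree H greedy (history t) t (λ s s<t → ≡-sym (history-agrees t s s<t))

  greedy-valid : ∀ t → ValidRound H greedy t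
  greedy-valid t =
    (λ v chosen → fresh (next (history t) t) v chosen ∘ spread-greedy t v) ,
    (λ none v → spread-history t v (exhausted (next (history t) t) none v))

  greedy-follows : ∀ t y → plan t ≡ just y → Burned H greedy (suc t) y
  greedy-follows t y planned with spread? H adj? greedy t y
  ... | yes spread = inj₁ spread
  ... | no  ¬spread = inj₂ (prefers (next (history t) t) y planned (¬spread ∘ spread-history t y))

covering-plan-burns : (H : Graph) → (∀ u v → Dec (Adj H u v)) → ∀ k (plan : Strategy H) →
                      (∀ a → Source H plan k a) → BurnsIn H k
covering-plan-burns H adj? k plan covers =
  greedy , (λ t _ → greedy-valid t) ,
  (λ a → source-burned H greedy plan k a greedy-follows (covers a))
  where open FollowPlan H adj? plan

module Shadow (G H : Graph) (S : Subgraph H G) (iso : IsIsometric H G S)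
  (balls : ∀ (x : Fin (n G)) → (¬ Σ (Fin (n H)) λ a → emb S a ≡ x) →
           ∀ (r : ℕ) → 1 ≤ r →
           Σ (Fin (n H)) λ y → ∀ (a : Fin (n H)) → Dist≤ G x (emb S a) r → Dist≤ H y a r) where

  IsShadow : Fin (n G) → ℕ → Maybe (Fin (n H)) → Set
  IsShadow x r s = ∀ a → Dist≤ G x (emb S a) r → Σ (Fin (n H)) λ y → s ≡ just y × Dist≤ H y a r

  shadow-by : ∀ x → Dec (Σ (Fin (n H)) λ b → emb S b ≡ x) → ∀ r → Σ (Maybe (Fin (n H))) (IsShadow x r)
  shadow-by x (yes (b , refl)) r = just b , λ a walk → b , refl , proj₂ (iso b a r) walk
  shadow-by x (no outside) zero =
    nothing , λ a walk → ⊥-elim (outside (a , ≡-sym (walk-zero walk)))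
  shadow-by x (no outside) (suc r) =
    just (proj₁ f) , λ a walk → proj₁ f , refl , proj₂ f a walk
    where f = balls x outside (suc r) (s≤s z≤n)

  shadow : Fin (n G) → ℕ → Maybe (Fin (n H))
  shadow x r = proj₁ (shadow-by x (any? (λ b → emb S b ≟Fin x)) r)

  shadow-spec : ∀ x r → IsShadow x r (shadow x r)
  shadow-spec x r = proj₂ (shadow-by x (any? (λ b → emb S b ≟Fin x)) r)

  shadow-plan : Strategy G → ℕ → Strategy H
  shadow-plan c k t with c t
  ... | just x  = shadow x (k ∸ suc t)
  ... | nothing = nothing

  shadow-source : ∀ c k a → Source G c k (emb S a) → Source H (shadow-plan c k) k a
  shadow-source c k a (t , x , cx , d , refl , walk)
    with shadow-spec x d a walk
  ... | y , sy , walkH = t , y , planned , d , refl , walkH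
    where
      planned : shadow-plan c (suc (t + d)) t ≡ just y
      planned rewrite cx | m+n∸m≡n (suc t) d = sy

theorem7 : (G H : Graph) (S : Subgraph H G) → IsIsometric H G S →
    (∀ (x : Fin (n G)) → (¬ Σ (Fin (n H)) λ a → emb S a ≡ x) →
      ∀ (r : ℕ) → 1 ≤ r →
      Σ (Fin (n H)) λ y → ∀ (a : Fin (n H)) → Dist≤ G x (emb S a) r → Dist≤ H y a r) →
    ∀ (bH bG : ℕ) → IsBurningNumber H bH → IsBurningNumber G bG → bH ≤ bG
theorem7 G H S iso balls bH bG (_ , H-needs-bH) ((c , _ , G-burnt) , _) with bH ≤? bG
... | yes bH≤bG = bH≤bG
... | no  bH≰bG = ⊥-elim (¬¬-adjacency-decidable H λ adj? →
        H-needs-bH bG (≰⇒> bH≰bG) (covering-plan-burns H adj? bG (shadow-plan c bG) covers))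
  where
    open Shadow G H S iso balls
    covers : ∀ a → Source H (shadow-plan c bG) bG a
    covers a = shadow-source c bG a (burned-has-source G c bG (emb S a) (G-burnt (emb S a)))
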